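{- Let $G=(V,E)$ be a finite simple undirected graph with $W>0$ (notation below). Fix any 3-path $P$ of $G$. Then the probability that the procedure $\mathtt{sample}$ outputs (the edge set of) $P$ is exactly $1/W$.
   Context: For a vertex $v$, $d_v$ denotes its degree and $N(v)$ its set of neighbours. A 3-path in $G$ is a set of three edges $\{(a,b),(b,c),(c,d)\}$ of $G$ where $a,b,c,d$ are four distinct vertices. For each edge $e=(u,v)\in E$ let $\tau_e=(d_u-1)(d_v-1)$ and let $W=\sum_{e\in E}\tau_e$. The randomized procedure $\mathtt{sample}$ is: pick an edge $e=(u,v)$ with probability $\tau_e/W$; pick $u'$ uniformly at random from $N(u)\setminus\{v\}$; independently pick $v'$ uniformly at random from $N(v)\setminus\{u\}$; output the edge set $\{(u',u),(u,v),(v,v')\}$. (The output may be a triangle, when $u'=v'$, or a 3-path.) -}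

module Defs where

open import Data.Nat using (ℕ; zero; suc; _∸_; _*_; _<_)
open import Data.Nat as ℕ using ()
open import Data.Fin using (Fin; toℕ)
open import Data.Fin as F using ()
open import Data.Bool using (Bool; true; false; _∧_; _∨_; not; if_then_else_; T)
open import Data.List using (List; []; _∷_; foldr; map)
open import Data.Bool.ListAction using (all; any)
open import Data.List using () renaming (allFin to allFinL)
open import Data.Product using (_×_; _,_)
open import Data.Integer using (+_)
open import Data.Rational using (ℚ; 0ℚ; _/_) renaming (_+_ to _+ℚ_; _*_ to _*ℚ_)
open import Relation.Nullary.Decidable using (⌊_⌋)
open import Relation.Binary.PropositionalEquality using (_≡_)

record Graph (n : ℕ) : Set where
  field
    adj   : Fin n → Fin n → Bool
    sym   : ∀ u v → adj u v ≡ adj v u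
    irref : ∀ u → adj u u ≡ false
open Graph public

_==_ : {n : ℕ} → Fin n → Fin n → Bool
x == y = ⌊ x F.≟ y ⌋

_<ᵇ_ : {n : ℕ} → Fin n → Fin n → Bool
x <ᵇ y = ⌊ toℕ x ℕ.<? toℕ y ⌋

Σℚ : {n : ℕ} → (Fin n → ℚ) → ℚ
Σℚ {n} f = foldr (λ i acc → f i +ℚ acc) 0ℚ (allFinL n)

Σℕ : {n : ℕ} → (Fin n → ℕ) → ℕ
Σℕ {n} f = foldr (λ i acc → f i ℕ.+ acc) 0 (allFinL n)

[_]ℚ : Bool → ℚ → ℚ
[ b ]ℚ x = if b then x else 0ℚ

[_]ℕ : Bool → ℕ → ℕ
[ b ]ℕ x = if b then x else 0

deg : {n : ℕ} → Graph n → Fin n → ℕ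
deg G u = Σℕ (λ v → [ adj G u v ]ℕ 1)

τ : {n : ℕ} → Graph n → Fin n → Fin n → ℕ
τ G u v = (deg G u ∸ 1) * (deg G v ∸ 1)

-- W = Σ_{e ∈ E} τ_e ; each unordered edge {u,v} is counted once, via u < v.
W : {n : ℕ} → Graph n → ℕ
W G = Σℕ (λ u → Σℕ (λ v → [ adj G u v ∧ (u <ᵇ v) ]ℕ (τ G u v)))

-- a / d as a rational; only ever used with d ≠ 0 (the 0 case is a dummy).
frac : ℕ → ℕ → ℚ
frac a zero    = 0ℚ
frac a (suc d) = (+ a) / suc d

-- Unordered edges and finite edge sets (lists of edges, compared as sets).
Edge : ℕ → Set
Edge n = Fin n × Fin n

sameEdge : {n : ℕ} → Edge n → Edge n → Bool
sameEdge (x , y) (x' , y') = (x == x' ∧ y == y') ∨ (x == y' ∧ y == x')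

_∈ᵇ_ : {n : ℕ} → Edge n → List (Edge n) → Bool
e ∈ᵇ L = any (sameEdge e) L

sameSet : {n : ℕ} → List (Edge n) → List (Edge n) → Bool
sameSet L M = all (λ e → e ∈ᵇ M) L ∧ all (λ e → e ∈ᵇ L) M

-- The edge set output by `sample` for choices e = (u,v), u', v'.
output : {n : ℕ} → Fin n → Fin n → Fin n → Fin n → List (Edge n)
output u v u' v' = (u' , u) ∷ (u , v) ∷ (v , v') ∷ []

-- Probability that `sample` picks e = (u,v) (u < v, u ~ v), then u' and v':
--   τ_e / W · 1/|N(u)∖{v}| · 1/|N(v)∖{u}|,  with |N(u)∖{v}| = d_u - 1.
-- Probability that `sample` outputs the edge set S: sum over all choices
-- (u,v,u',v') that are possible (u<v, u~v, u'∈N(u)∖{v}, v'∈N(v)∖{u})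
-- and whose output edge set equals S.
probOutput : {n : ℕ} → Graph n → List (Edge n) → ℚ
probOutput G S =
  Σℚ (λ u → Σℚ (λ v → Σℚ (λ u' → Σℚ (λ v' →
    [ adj G u v ∧ (u <ᵇ v)
      ∧ (adj G u u' ∧ not (u' == v))
      ∧ (adj G v v' ∧ not (v' == u))
      ∧ sameSet (output u v u' v') S ]ℚ
      (frac (τ G u v) (W G) *ℚ frac 1 (deg G u ∸ 1) *ℚ frac 1 (deg G v ∸ 1))))))

Is3Path : {n : ℕ} → Graph n → Fin n → Fin n → Fin n → Fin n → Set
Is3Path G a b c d =
  T (adj G a b) × T (adj G b c) × T (adj G c d) ×
  T (not (a == b) ∧ not (a == c) ∧ not (a == d) ∧
     not (b == c) ∧ not (b == d) ∧ not (c == d))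

pathEdges : {n : ℕ} → Fin n → Fin n → Fin n → Fin n → List (Edge n)
pathEdges a b c d = (a , b) ∷ (b , c) ∷ (c , d) ∷ []

module Submission where

-- The output of a choice (u, v, u', v') is the edge list u'u, uv, vv'.  If
-- it is the edge set of the path, each of its three edges is a path edge
-- and u' ≠ v, v' ≠ u; a short case analysis on the middle edge shows that
-- the choice is then one of the two traversals (b, c, a, d) or its reversal
-- (c, b, d, a).  Since `sample` only picks edges with u < v, exactly one of
-- the two is admissible, so the probability sum collapses to the single
-- term of the edge bc (say) with its two outer neighbours:
--     τ_bc/W · 1/(d_b − 1) · 1/(d_c − 1) = 1/W,
-- where d_b, d_c ≥ 2 because b and c each have two distinct neighbours.

open import Defs hiding (sym)
open import Data.Nat using (ℕ; zero; suc; _+_; _<_; _≤_; _∸_; _*_)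
open import Data.Nat.Properties using (m≤m+n; m≤n+m; +-monoʳ-≤; +-comm; ≤-trans; ≤-reflexive; m<n⇒0<n∸m; <-asym; <-cmp)
open import Data.Nat.Tactic.RingSolver using (solve-∀)
open import Data.Fin using (Fin; toℕ; _≟_) renaming (zero to fzero; suc to fsuc)
open import Data.Fin.Properties using (suc-injective; toℕ-injective)
open import Data.Integer using (+_)
open import Data.Rational using (ℚ; 0ℚ; fromℚᵘ) renaming (_+_ to _+ℚ_; _*_ to _*ℚ_)
open import Data.Rational.Properties using (+-identityˡ; +-identityʳ; toℚᵘ-injective; toℚᵘ-homo-*; toℚᵘ-fromℚᵘ; fromℚᵘ-cong)
open import Data.Rational.Unnormalised using (ℚᵘ; mkℚᵘ; *≡*) renaming (_*_ to _*ᵘ_)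
import Data.Rational.Unnormalised.Properties as ℚᵘ
open import Data.Bool using (Bool; true; false; _∧_; not; T)
open import Data.Bool.Properties using (T-∧; T-∨)
open import Data.Bool.ListAction using (all)
open import Data.List.Relation.Unary.All using (All; []; _∷_)
open import Data.List.Relation.Unary.All.Properties using (all⁺; all⁻)
open import Data.List.Relation.Unary.Any using (Any; here; there)
open import Data.List.Relation.Unary.Any.Properties using (any⁺; any⁻)
open import Data.List using (List; foldr; map; allFin; tabulate)
open import Data.List.Properties using (map-tabulate; foldr-map)
open import Data.Product using (_×_; _,_; proj₁; proj₂)
open import Data.Sum using (_⊎_; inj₁; inj₂; swap)
open import Data.Empty using (⊥-elim)
open import Data.Unit using (tt)
open import Function using (_∘_; id; case_of_)
open import Function.Bundles using (Equivalence)
open import Relation.Binary.Definitions using (tri<; tri≈; tri>)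
open import Relation.Nullary using (¬_; yes; no)
open import Relation.Nullary.Decidable using (toWitness; fromWitness)
open import Relation.Binary.PropositionalEquality using (_≡_; _≢_; refl; sym; cong; cong₂; subst; module ≡-Reasoning)

open Equivalence using (to; from)
open ≡-Reasoning

-- Finite sums over Fin n

foldr-allFin-suc : ∀ {A : Set} (_∙_ : A → A → A) (ε : A) {n} (f : Fin (suc n) → A) →
  foldr (λ i acc → f i ∙ acc) ε (allFin (suc n)) ≡
  f fzero ∙ foldr (λ i acc → f (fsuc i) ∙ acc) ε (allFin n)
foldr-allFin-suc {A} _∙_ ε {n} f = cong (f fzero ∙_) (begin
  foldr step ε (tabulate fsuc)        ≡⟨ cong (foldr step ε) (map-tabulate id fsuc) ⟨
  foldr step ε (map fsuc (allFin n))  ≡⟨ foldr-map step fsuc ε (allFin n) ⟩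
  foldr (λ i acc → f (fsuc i) ∙ acc) ε (allFin n) ∎)
  where
  step : Fin (suc n) → A → A
  step i acc = f i ∙ acc

Σℚ-suc : ∀ {n} (f : Fin (suc n) → ℚ) → Σℚ f ≡ f fzero +ℚ Σℚ (f ∘ fsuc)
Σℚ-suc = foldr-allFin-suc _+ℚ_ 0ℚ

Σℕ-suc : ∀ {n} (f : Fin (suc n) → ℕ) → Σℕ f ≡ f fzero + Σℕ (f ∘ fsuc)
Σℕ-suc = foldr-allFin-suc _+_ 0

Σℚ-zero : ∀ {n} (f : Fin n → ℚ) → (∀ i → f i ≡ 0ℚ) → Σℚ f ≡ 0ℚ
Σℚ-zero {zero}  f f≡0 = refl
Σℚ-zero {suc n} f f≡0 = begin
  Σℚ f                    ≡⟨ Σℚ-suc f ⟩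
  f fzero +ℚ Σℚ (f ∘ fsuc) ≡⟨ cong₂ _+ℚ_ (f≡0 fzero) (Σℚ-zero (f ∘ fsuc) (f≡0 ∘ fsuc)) ⟩
  0ℚ                      ∎

Σℚ-single : ∀ {n} (f : Fin n → ℚ) (i₀ : Fin n) → (∀ i → i ≢ i₀ → f i ≡ 0ℚ) → Σℚ f ≡ f i₀
Σℚ-single {suc n} f fzero off = begin
  Σℚ f                     ≡⟨ Σℚ-suc f ⟩
  f fzero +ℚ Σℚ (f ∘ fsuc) ≡⟨ cong (f fzero +ℚ_) (Σℚ-zero (f ∘ fsuc) (λ i → off (fsuc i) λ ())) ⟩
  f fzero +ℚ 0ℚ            ≡⟨ +-identityʳ (f fzero) ⟩
  f fzero                  ∎
Σℚ-single {suc n} f (fsuc j) off = begin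
  Σℚ f                     ≡⟨ Σℚ-suc f ⟩
  f fzero +ℚ Σℚ (f ∘ fsuc) ≡⟨ cong₂ _+ℚ_ (off fzero λ ())
                                (Σℚ-single (f ∘ fsuc) j (λ i i≢j → off (fsuc i) (i≢j ∘ suc-injective))) ⟩
  0ℚ +ℚ f (fsuc j)         ≡⟨ +-identityˡ (f (fsuc j)) ⟩
  f (fsuc j)               ∎

Σℚ⁴-single : ∀ {n} (f : Fin n → Fin n → Fin n → Fin n → ℚ) (u₀ v₀ p₀ q₀ : Fin n) →
  (∀ u v p q → (u , v , p , q) ≢ (u₀ , v₀ , p₀ , q₀) → f u v p q ≡ 0ℚ) →
  Σℚ (λ u → Σℚ (λ v → Σℚ (λ p → Σℚ (λ q → f u v p q)))) ≡ f u₀ v₀ p₀ q₀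
Σℚ⁴-single f u₀ v₀ p₀ q₀ off = begin
  Σℚ (λ u → Σℚ (λ v → Σℚ (λ p → Σℚ (λ q → f u v p q))))
    ≡⟨ Σℚ-single _ u₀ (λ u u≢ → Σℚ-zero _ λ v → Σℚ-zero _ λ p → Σℚ-zero _ λ q →
         off u v p q (u≢ ∘ cong proj₁)) ⟩
  Σℚ (λ v → Σℚ (λ p → Σℚ (λ q → f u₀ v p q)))
    ≡⟨ Σℚ-single _ v₀ (λ v v≢ → Σℚ-zero _ λ p → Σℚ-zero _ λ q →
         off u₀ v p q (v≢ ∘ cong (proj₁ ∘ proj₂))) ⟩
  Σℚ (λ p → Σℚ (λ q → f u₀ v₀ p q))
    ≡⟨ Σℚ-single _ p₀ (λ p p≢ → Σℚ-zero _ λ q →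
         off u₀ v₀ p q (p≢ ∘ cong (proj₁ ∘ proj₂ ∘ proj₂))) ⟩
  Σℚ (λ q → f u₀ v₀ p₀ q)
    ≡⟨ Σℚ-single _ q₀ (λ q q≢ → off u₀ v₀ p₀ q (q≢ ∘ cong (proj₂ ∘ proj₂ ∘ proj₂))) ⟩
  f u₀ v₀ p₀ q₀ ∎

Σℕ-term : ∀ {n} (f : Fin n → ℕ) i → f i ≤ Σℕ f
Σℕ-term f fzero    = ≤-trans (m≤m+n _ _) (≤-reflexive (sym (Σℕ-suc f)))
Σℕ-term f (fsuc i) = ≤-trans (≤-trans (Σℕ-term (f ∘ fsuc) i) (m≤n+m _ _)) (≤-reflexive (sym (Σℕ-suc f)))

Σℕ-pair : ∀ {n} (f : Fin n → ℕ) i j → i ≢ j → f i + f j ≤ Σℕ f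
Σℕ-pair f fzero    fzero    i≢j = ⊥-elim (i≢j refl)
Σℕ-pair f fzero    (fsuc j) _   =
  ≤-trans (+-monoʳ-≤ (f fzero) (Σℕ-term (f ∘ fsuc) j)) (≤-reflexive (sym (Σℕ-suc f)))
Σℕ-pair f (fsuc i) fzero    _   =
  ≤-trans (≤-reflexive (+-comm (f (fsuc i)) (f fzero)))
    (≤-trans (+-monoʳ-≤ (f fzero) (Σℕ-term (f ∘ fsuc) i)) (≤-reflexive (sym (Σℕ-suc f))))
Σℕ-pair f (fsuc i) (fsuc j) i≢j =
  ≤-trans (≤-trans (Σℕ-pair (f ∘ fsuc) i j (i≢j ∘ cong fsuc)) (m≤n+m _ _)) (≤-reflexive (sym (Σℕ-suc f)))

∧-intro : ∀ {x y} → T x → T y → T (x ∧ y)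
∧-intro tx ty = from T-∧ (tx , ty)

-- The left conjunct is given explicitly: it cannot be inferred from x ∧ y.
∧-fst : ∀ x {y} → T (x ∧ y) → T x
∧-fst x = proj₁ ∘ to (T-∧ {x})

∧-snd : ∀ x {y} → T (x ∧ y) → T y
∧-snd x = proj₂ ∘ to (T-∧ {x})

==⇒≡ : ∀ {n} {x y : Fin n} → T (x == y) → x ≡ y
==⇒≡ = toWitness

≡⇒== : ∀ {n} {x y : Fin n} → x ≡ y → T (x == y)
≡⇒== = fromWitness

≢⇒not== : ∀ {n} {x y : Fin n} → x ≢ y → T (not (x == y))
≢⇒not== {x = x} {y} x≢y with x ≟ y
... | yes x≡y = x≢y x≡y
... | no _    = tt

not==⇒≢ : ∀ {n} {x y : Fin n} → T (not (x == y)) → x ≢ y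
not==⇒≢ {x = x} {y} t with x ≟ y
... | yes _   = ⊥-elim t
... | no x≢y  = x≢y

<ᵇ-asym : ∀ {n} {x y : Fin n} → T (x <ᵇ y) → ¬ T (y <ᵇ x)
<ᵇ-asym x<y y<x = <-asym (toWitness x<y) (toWitness y<x)

-- Distinct vertices are comparable, which fixes the orientation of an edge.
<ᵇ-total : ∀ {n} {x y : Fin n} → x ≢ y → T (x <ᵇ y) ⊎ T (y <ᵇ x)
<ᵇ-total {x = x} {y} x≢y with <-cmp (toℕ x) (toℕ y)
... | tri< x<y _ _ = inj₁ (fromWitness x<y)
... | tri≈ _ x≡y _ = ⊥-elim (x≢y (toℕ-injective x≡y))
... | tri> _ _ y<x = inj₂ (fromWitness y<x)

[]ℚ-true : ∀ {b} x → T b → [ b ]ℚ x ≡ x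
[]ℚ-true {true} x _ = refl

[]ℚ-false : ∀ {b} x → ¬ T b → [ b ]ℚ x ≡ 0ℚ
[]ℚ-false {false} x _  = refl
[]ℚ-false {true}  x ¬t = ⊥-elim (¬t tt)

[]ℕ-true : ∀ {b} x → T b → [ b ]ℕ x ≡ x
[]ℕ-true {true} x _ = refl

sameEdge-refl : ∀ {n} (x y : Fin n) → T (sameEdge (x , y) (x , y))
sameEdge-refl x y = from (T-∨ {x == x ∧ y == y}) (inj₁ (∧-intro (≡⇒== {x = x} refl) (≡⇒== {x = y} refl)))

sameEdge-flip : ∀ {n} (x y : Fin n) → T (sameEdge (x , y) (y , x))
sameEdge-flip x y = from (T-∨ {x == y ∧ y == x}) (inj₂ (∧-intro (≡⇒== {x = x} refl) (≡⇒== {x = y} refl)))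

sameEdge⇒ : ∀ {n} {x y p q : Fin n} → T (sameEdge (x , y) (p , q)) →
  (x ≡ p × y ≡ q) ⊎ (x ≡ q × y ≡ p)
sameEdge⇒ {x = x} {y} {p} {q} t with to (T-∨ {x == p ∧ y == q}) t
... | inj₁ s = inj₁ (==⇒≡ (∧-fst (x == p) s) , ==⇒≡ (∧-snd (x == p) s))
... | inj₂ s = inj₂ (==⇒≡ (∧-fst (x == q) s) , ==⇒≡ (∧-snd (x == q) s))

∈ᵇ-intro : ∀ {n} (e : Edge n) L → Any (λ e' → T (sameEdge e e')) L → T (e ∈ᵇ L)
∈ᵇ-intro e L = any⁺ (sameEdge e)

∈ᵇ-elim : ∀ {n} (e : Edge n) L → T (e ∈ᵇ L) → Any (λ e' → T (sameEdge e e')) L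
∈ᵇ-elim e L = any⁻ (sameEdge e) L

sameSet-intro : ∀ {n} (L M : List (Edge n)) →
  All (λ e → T (e ∈ᵇ M)) L → All (λ e → T (e ∈ᵇ L)) M → T (sameSet L M)
sameSet-intro L M L⊆M M⊆L = ∧-intro (all⁻ (_∈ᵇ M) L⊆M) (all⁻ (_∈ᵇ L) M⊆L)

fromℚᵘ-homo-* : ∀ p q → fromℚᵘ (p *ᵘ q) ≡ fromℚᵘ p *ℚ fromℚᵘ q
fromℚᵘ-homo-* p q = toℚᵘ-injective (ℚᵘ.≃-trans (toℚᵘ-fromℚᵘ (p *ᵘ q))
  (ℚᵘ.≃-sym (ℚᵘ.≃-trans (toℚᵘ-homo-* (fromℚᵘ p) (fromℚᵘ q)) (ℚᵘ.*-cong (toℚᵘ-fromℚᵘ p) (toℚᵘ-fromℚᵘ q)))))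

frac-cancel : ∀ {x y w} → 0 < x → 0 < y → 0 < w →
  frac (x * y) w *ℚ frac 1 x *ℚ frac 1 y ≡ frac 1 w
frac-cancel {suc x} {suc y} {suc w} _ _ _ = begin
  fromℚᵘ p *ℚ fromℚᵘ q *ℚ fromℚᵘ r ≡⟨ cong (_*ℚ fromℚᵘ r) (fromℚᵘ-homo-* p q) ⟨
  fromℚᵘ (p *ᵘ q) *ℚ fromℚᵘ r     ≡⟨ fromℚᵘ-homo-* (p *ᵘ q) r ⟨
  fromℚᵘ (p *ᵘ q *ᵘ r)             ≡⟨ fromℚᵘ-cong {p *ᵘ q *ᵘ r} {mkℚᵘ (+ 1) w}
                                        (*≡* (cong +_ (cross (suc x) (suc y) (suc w)))) ⟩
  fromℚᵘ (mkℚᵘ (+ 1) w)            ∎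
  where
  p q r : ℚᵘ
  p = mkℚᵘ (+ (suc x * suc y)) w
  q = mkℚᵘ (+ 1) x
  r = mkℚᵘ (+ 1) y
  -- the cross-multiplied form of  (xy/w)(1/x)(1/y) = 1/w
  cross : ∀ x y w → x * y * 1 * 1 * w ≡ 1 * (w * x * y)
  cross = solve-∀

deg-pred-pos : ∀ {n} (G : Graph n) {u x y} → x ≢ y → T (adj G u x) → T (adj G u y) → 0 < deg G u ∸ 1
deg-pred-pos G {u} {x} {y} x≢y u~x u~y = m<n⇒0<n∸m (≤-trans two≤ (Σℕ-pair neighbour x y x≢y))
  where
  neighbour : Fin _ → ℕ
  neighbour v = [ adj G u v ]ℕ 1
  two≤ : 2 ≤ neighbour x + neighbour y
  two≤ = ≤-reflexive (sym (cong₂ _+_ ([]ℕ-true 1 u~x) ([]ℕ-true 1 u~y)))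

adj-sym : ∀ {n} (G : Graph n) {x y} → T (adj G x y) → T (adj G y x)
adj-sym G {x} {y} = subst T (Graph.sym G x y)

-- The probability of an output edge set, as a sum over admissible choices

admissible : ∀ {n} → Graph n → List (Edge n) → Fin n → Fin n → Fin n → Fin n → Bool
admissible G S u v u' v' =
  adj G u v ∧ (u <ᵇ v)
  ∧ (adj G u u' ∧ not (u' == v))
  ∧ (adj G v v' ∧ not (v' == u))
  ∧ sameSet (output u v u' v') S

weight : ∀ {n} → Graph n → Fin n → Fin n → ℚ
weight G u v = frac (τ G u v) (W G) *ℚ frac 1 (deg G u ∸ 1) *ℚ frac 1 (deg G v ∸ 1)

admissible-intro : ∀ {n} (G : Graph n) S {u v u' v'} →
  T (adj G u v) → T (u <ᵇ v) → T (adj G u u') → u' ≢ v → T (adj G v v') → v' ≢ u →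
  T (sameSet (output u v u' v') S) → T (admissible G S u v u' v')
admissible-intro G S u~v u<v u~u' u'≢v v~v' v'≢u same =
  ∧-intro u~v (∧-intro u<v (∧-intro (∧-intro u~u' (≢⇒not== u'≢v))
    (∧-intro (∧-intro v~v' (≢⇒not== v'≢u)) same)))

admissible⇒< : ∀ {n} (G : Graph n) S {u v u' v'} → T (admissible G S u v u' v') → T (u <ᵇ v)
admissible⇒< G S {u} {v} adm = ∧-fst (u <ᵇ v) (∧-snd (adj G u v) adm)

admissible⇒ : ∀ {n} (G : Graph n) S {u v u' v'} → T (admissible G S u v u' v') →
  u' ≢ v × v' ≢ u × All (λ e → T (e ∈ᵇ S)) (output u v u' v')
admissible⇒ G S {u} {v} {u'} {v'} adm =
  not==⇒≢ u'≢ᵇv , not==⇒≢ v'≢ᵇu , all⁺ (_∈ᵇ S) (output u v u' v') output⊆S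
  where
  choice-u' choice-v' : Bool
  choice-u' = adj G u u' ∧ not (u' == v)
  choice-v' = adj G v v' ∧ not (v' == u)
  choices : T (choice-u' ∧ choice-v' ∧ sameSet (output u v u' v') S)
  choices = ∧-snd (u <ᵇ v) (∧-snd (adj G u v) adm)
  u'≢ᵇv : T (not (u' == v))
  u'≢ᵇv = ∧-snd (adj G u u') (∧-fst choice-u' choices)
  v'≢ᵇu : T (not (v' == u))
  v'≢ᵇu = ∧-snd (adj G v v') (∧-fst choice-v' (∧-snd choice-u' choices))
  output⊆S : T (all (_∈ᵇ S) (output u v u' v'))
  output⊆S = ∧-fst (all (_∈ᵇ S) (output u v u' v')) (∧-snd choice-v' (∧-snd choice-u' choices))

-- If the only admissible choices are t₀ = (u₀, v₀, p₀, q₀) and its reversal,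
-- the reversal is excluded by u < v and probOutput is the weight of t₀.
probOutput-unique : ∀ {n} (G : Graph n) (S : List (Edge n)) {u₀ v₀ p₀ q₀ : Fin n} →
  T (admissible G S u₀ v₀ p₀ q₀) →
  (∀ {u v p q} → T (admissible G S u v p q) →
     (u , v , p , q) ≡ (u₀ , v₀ , p₀ , q₀) ⊎ (u , v , p , q) ≡ (v₀ , u₀ , q₀ , p₀)) →
  probOutput G S ≡ weight G u₀ v₀
probOutput-unique {n} G S {u₀} {v₀} {p₀} {q₀} adm₀ only = begin
  probOutput G S                                  ≡⟨ Σℚ⁴-single term u₀ v₀ p₀ q₀ vanish ⟩
  [ admissible G S u₀ v₀ p₀ q₀ ]ℚ (weight G u₀ v₀) ≡⟨ []ℚ-true (weight G u₀ v₀) adm₀ ⟩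
  weight G u₀ v₀                                  ∎
  where
  term : Fin n → Fin n → Fin n → Fin n → ℚ
  term u v p q = [ admissible G S u v p q ]ℚ (weight G u v)
  vanish : ∀ u v p q → (u , v , p , q) ≢ (u₀ , v₀ , p₀ , q₀) → term u v p q ≡ 0ℚ
  vanish u v p q t≢t₀ = []ℚ-false (weight G u v) λ adm → case only adm of λ where
    (inj₁ t≡t₀) → t≢t₀ t≡t₀
    (inj₂ refl) → <ᵇ-asym (admissible⇒< G S adm₀) (admissible⇒< G S adm)

-- The combinatorics of a 3-path a–b–c–d

data PathEdge {n} (a b c d : Fin n) : Fin n → Fin n → Set where
  a-b : PathEdge a b c d a b
  b-a : PathEdge a b c d b a
  b-c : PathEdge a b c d b c
  c-b : PathEdge a b c d c b
  c-d : PathEdge a b c d c d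
  d-c : PathEdge a b c d d c

flip : ∀ {n} {a b c d x y : Fin n} → PathEdge a b c d x y → PathEdge a b c d y x
flip a-b = b-a
flip b-a = a-b
flip b-c = c-b
flip c-b = b-c
flip c-d = d-c
flip d-c = c-d

fromSameEdge : ∀ {n} {a b c d x y p q : Fin n} →
  PathEdge a b c d p q → T (sameEdge (x , y) (p , q)) → PathEdge a b c d x y
fromSameEdge {x = x} {y} {p} {q} e s with sameEdge⇒ {x = x} {y} {p} {q} s
... | inj₁ (refl , refl) = e
... | inj₂ (refl , refl) = flip e

∈path⇒PathEdge : ∀ {n} {a b c d x y : Fin n} →
  T ((x , y) ∈ᵇ pathEdges a b c d) → PathEdge a b c d x y
∈path⇒PathEdge {a = a} {b} {c} {d} {x} {y} t with ∈ᵇ-elim (x , y) (pathEdges a b c d) t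
... | here s                 = fromSameEdge a-b s
... | there (here s)         = fromSameEdge b-c s
... | there (there (here s)) = fromSameEdge c-d s

path-sameSet : ∀ {n} (a b c d : Fin n) → T (sameSet (output b c a d) (pathEdges a b c d))
path-sameSet {n} a b c d = sameSet-intro P P P⊆P P⊆P
  where
  P : List (Edge n)
  P = pathEdges a b c d
  P⊆P : All (λ e → T (e ∈ᵇ P)) P
  P⊆P = ∈ᵇ-intro (a , b) P (here (sameEdge-refl a b))
      ∷ ∈ᵇ-intro (b , c) P (there (here (sameEdge-refl b c)))
      ∷ ∈ᵇ-intro (c , d) P (there (there (here (sameEdge-refl c d))))
      ∷ []

reversed-sameSet : ∀ {n} (a b c d : Fin n) → T (sameSet (output c b d a) (pathEdges a b c d))
reversed-sameSet {n} a b c d = sameSet-intro R P R⊆P P⊆R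
  where
  P R : List (Edge n)
  P = pathEdges a b c d
  R = output c b d a
  R⊆P : All (λ e → T (e ∈ᵇ P)) R
  R⊆P = ∈ᵇ-intro (d , c) P (there (there (here (sameEdge-flip d c))))
      ∷ ∈ᵇ-intro (c , b) P (there (here (sameEdge-flip c b)))
      ∷ ∈ᵇ-intro (b , a) P (here (sameEdge-flip b a))
      ∷ []
  P⊆R : All (λ e → T (e ∈ᵇ R)) P
  P⊆R = ∈ᵇ-intro (a , b) R (there (there (here (sameEdge-flip a b))))
      ∷ ∈ᵇ-intro (b , c) R (there (here (sameEdge-flip b c)))
      ∷ ∈ᵇ-intro (c , d) R (here (sameEdge-flip c d))
      ∷ []

record Distinct {n} (a b c d : Fin n) : Set where
  field
    a≢b : a ≢ b
    a≢c : a ≢ c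
    a≢d : a ≢ d
    b≢c : b ≢ c
    b≢d : b ≢ d
    c≢d : c ≢ d

distinct-vertices : ∀ {n} {a b c d : Fin n} →
  T (not (a == b) ∧ not (a == c) ∧ not (a == d) ∧ not (b == c) ∧ not (b == d) ∧ not (c == d)) →
  Distinct a b c d
distinct-vertices {a = a} {b} {c} {d} t = record
  { a≢b = not==⇒≢ (∧-fst ab t)  ; a≢c = not==⇒≢ (∧-fst ac t₁) ; a≢d = not==⇒≢ (∧-fst ad t₂)
  ; b≢c = not==⇒≢ (∧-fst bc t₃) ; b≢d = not==⇒≢ (∧-fst bd t₄) ; c≢d = not==⇒≢ (∧-snd bd t₄)
  }
  where
  ab ac ad bc bd cd : Bool
  ab = not (a == b); ac = not (a == c); ad = not (a == d)
  bc = not (b == c); bd = not (b == d); cd = not (c == d)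
  t₁ : T (ac ∧ ad ∧ bc ∧ bd ∧ cd)
  t₁ = ∧-snd ab t
  t₂ : T (ad ∧ bc ∧ bd ∧ cd)
  t₂ = ∧-snd ac t₁
  t₃ : T (bc ∧ bd ∧ cd)
  t₃ = ∧-snd ad t₂
  t₄ : T (bd ∧ cd)
  t₄ = ∧-snd bc t₃

module _ {n} {a b c d : Fin n} (distinct : Distinct a b c d) where
  open Distinct distinct

  out-a : ∀ {y} → PathEdge a b c d a y → y ≡ b
  out-a a-b = refl
  out-a b-a = ⊥-elim (a≢b refl)
  out-a b-c = ⊥-elim (a≢b refl)
  out-a c-b = ⊥-elim (a≢c refl)
  out-a c-d = ⊥-elim (a≢c refl)
  out-a d-c = ⊥-elim (a≢d refl)

  out-d : ∀ {y} → PathEdge a b c d d y → y ≡ c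
  out-d a-b = ⊥-elim (a≢d refl)
  out-d b-a = ⊥-elim (b≢d refl)
  out-d b-c = ⊥-elim (b≢d refl)
  out-d c-b = ⊥-elim (c≢d refl)
  out-d c-d = ⊥-elim (c≢d refl)
  out-d d-c = refl

  out-b : ∀ {y} → PathEdge a b c d b y → y ≡ a ⊎ y ≡ c
  out-b a-b = ⊥-elim (a≢b refl)
  out-b b-a = inj₁ refl
  out-b b-c = inj₂ refl
  out-b c-b = ⊥-elim (b≢c refl)
  out-b c-d = ⊥-elim (b≢c refl)
  out-b d-c = ⊥-elim (b≢d refl)

  out-c : ∀ {y} → PathEdge a b c d c y → y ≡ b ⊎ y ≡ d
  out-c a-b = ⊥-elim (a≢c refl)
  out-c b-a = ⊥-elim (b≢c refl)
  out-c b-c = ⊥-elim (b≢c refl)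
  out-c c-b = inj₁ refl
  out-c c-d = inj₂ refl
  out-c d-c = ⊥-elim (c≢d refl)

  traversals : ∀ {u v u' v'} →
    PathEdge a b c d u' u → PathEdge a b c d u v → PathEdge a b c d v v' → u' ≢ v → v' ≢ u →
    (u , v , u' , v') ≡ (b , c , a , d) ⊎ (u , v , u' , v') ≡ (c , b , d , a)
  traversals e₁ a-b e₃ u'≢v _ = ⊥-elim (u'≢v (out-a (flip e₁)))
  traversals e₁ b-a e₃ _ v'≢u = ⊥-elim (v'≢u (out-a e₃))
  traversals e₁ c-d e₃ _ v'≢u = ⊥-elim (v'≢u (out-d e₃))
  traversals e₁ d-c e₃ u'≢v _ = ⊥-elim (u'≢v (out-d (flip e₁)))
  traversals e₁ b-c e₃ u'≢v v'≢u with out-b (flip e₁) | out-c e₃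
  ... | inj₁ refl | inj₂ refl = inj₁ refl
  ... | inj₂ u'≡c | _         = ⊥-elim (u'≢v u'≡c)
  ... | _         | inj₁ v'≡b = ⊥-elim (v'≢u v'≡b)
  traversals e₁ c-b e₃ u'≢v v'≢u with out-c (flip e₁) | out-b e₃
  ... | inj₂ refl | inj₁ refl = inj₂ refl
  ... | inj₁ u'≡b | _         = ⊥-elim (u'≢v u'≡b)
  ... | _         | inj₂ v'≡c = ⊥-elim (v'≢u v'≡c)

  admissible-traversals : (G : Graph n) → ∀ {u v u' v'} →
    T (admissible G (pathEdges a b c d) u v u' v') →
    (u , v , u' , v') ≡ (b , c , a , d) ⊎ (u , v , u' , v') ≡ (c , b , d , a)
  admissible-traversals G adm with admissible⇒ G (pathEdges a b c d) adm
  ... | u'≢v , v'≢u , e₁ ∷ e₂ ∷ e₃ ∷ [] =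
    traversals (∈path⇒PathEdge e₁) (∈path⇒PathEdge e₂) (∈path⇒PathEdge e₃) u'≢v v'≢u

claim1 : {n : ℕ} (G : Graph n) → 0 < W G →
         (a b c d : Fin n) → Is3Path G a b c d →
         probOutput G (pathEdges a b c d) ≡ frac 1 (W G)
claim1 G W>0 a b c d (a~b , b~c , c~d , distinctᵇ) = case <ᵇ-total b≢c of λ where
    (inj₁ b<c) → begin
      probOutput G P ≡⟨ probOutput-unique G P (forward b<c) (admissible-traversals distinct G) ⟩
      weight G b c   ≡⟨ frac-cancel deg-b deg-c W>0 ⟩
      frac 1 (W G)   ∎
    (inj₂ c<b) → begin
      probOutput G P ≡⟨ probOutput-unique G P (backward c<b) (swap ∘ admissible-traversals distinct G) ⟩
      weight G c b   ≡⟨ frac-cancel deg-c deg-b W>0 ⟩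
      frac 1 (W G)   ∎
  where
  P : List (Edge _)
  P = pathEdges a b c d
  distinct : Distinct a b c d
  distinct = distinct-vertices distinctᵇ
  open Distinct distinct
  deg-b : 0 < deg G b ∸ 1
  deg-b = deg-pred-pos G a≢c (adj-sym G a~b) b~c
  deg-c : 0 < deg G c ∸ 1
  deg-c = deg-pred-pos G b≢d (adj-sym G b~c) c~d
  forward : T (b <ᵇ c) → T (admissible G P b c a d)
  forward b<c = admissible-intro G P b~c b<c (adj-sym G a~b) a≢c c~d (b≢d ∘ sym) (path-sameSet a b c d)
  backward : T (c <ᵇ b) → T (admissible G P c b d a)
  backward c<b = admissible-intro G P (adj-sym G b~c) c<b c~d (b≢d ∘ sym) (adj-sym G a~b) a≢c
                   (reversed-sameSet a b c d)
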